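{- Let $k \geq 1$ be an integer. The signed projective cube $(H_k,\Sigma)$ of dimension $k$ is $2^{k-1}$-critical. Furthermore, it has $k+1$ pairwise disjoint $2^{k-1}$-signatures.
   Context: The projective cube $H_k$ has as vertex set the $2^k$ binary strings of length $k$; for each pair of strings at Hamming distance $1$ there is an edge, and for each pair of strings at Hamming distance $k$ there is an edge (so for $k=1$ the two vertices are joined by two parallel edges). The signed projective cube $(H_k,\Sigma)$ has $\Sigma$ equal to the set of edges joining strings at Hamming distance $k$ (for $k=1$, exactly one of the two parallel edges is negative). A signed graph $(G,\Sigma)$ is a graph with a set $\Sigma\subseteq E(G)$ of negative edges; a circuit is negative if it has an odd number of edges in $\Sigma$, and $(G,\Sigma)$ is balanced if it has no negative circuit. For $U\subseteq V(G)$, $\partial(U)$ is the set of edges with exactly one end in $U$. A signature of $(G,\Sigma)$ is any set $\Sigma\,\Delta\,\partial(U)$ with $U\subseteq V(G)$; it is a $t$-signature if it has $t$ elements. The frustration index $l(G,\Sigma)$ is the minimum size of $E\subseteq E(G)$ with $(G-E,\Sigma-E)$ balanced. For $k\ge1$, $(G,\Sigma)$ is $k$-critical if $l(G,\Sigma)=k$ and $l(G-e,\Sigma-\{e\})<k$ for every edge $e$. -}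

module Defs where

open import Data.Nat using (ℕ; zero; suc; _+_; _<_; _≤_; _%_; _^_)
open import Data.Bool using (Bool; true; false; not; _xor_; if_then_else_)
open import Data.Fin using (Fin; zero; suc)
open import Data.Fin.Properties using () renaming (_≟_ to _≟F_)
open import Data.Vec using (Vec; []; _∷_; insertAt; map)
open import Data.Vec.Properties using (≡-dec)
open import Data.Bool.Properties using () renaming (_≟_ to _≟B_)
open import Data.List using (List; []; _∷_; length; filter; cartesianProduct; allFin; _++_)
import Data.List as L
open import Data.List.Membership.Propositional using (_∈_)
open import Data.Product using (Σ; _×_; _,_; ∃; ∃-syntax; proj₁; proj₂)
open import Data.Sum using (_⊎_; inj₁; inj₂)
open import Data.Unit using (⊤; tt)
open import Data.Empty using (⊥)
open import Relation.Nullary using (¬_; Dec; yes; no)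
open import Relation.Nullary.Decidable using (⌊_⌋)
open import Relation.Binary.PropositionalEquality using (_≡_; _≢_)
open import Relation.Binary using (DecidableEquality)
open import Data.Product.Properties using () renaming (≡-dec to ×-≡-dec)
open import Data.Sum.Properties using () renaming (≡-dec to ⊎-≡-dec)
open import Data.Unit.Properties using () renaming (_≟_ to _≟U_)
open import Function.Definitions using (Injective)

-- A graph is given by a vertex type V, an edge type E, an incidence map
-- 'ends' (each edge has two ends, possibly equal; parallel edges allowed),
-- and a finite duplicate-free list of edges 'edges' (the edge set E(G)).
-- Edge subsets (in particular signatures Σ) are Boolean predicates on E;
-- only their values on E(G) matter.

record Graph : Set₁ where
  field
    V     : Set
    E     : Set
    ends  : E → V × V
    edges : List E
open Graph public

EdgeSet : Graph → Set
EdgeSet G = E G → Bool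

Joins : (G : Graph) → E G → V G → V G → Set
Joins G e x y = (proj₁ (ends G e) ≡ x × proj₂ (ends G e) ≡ y)
              ⊎ (proj₁ (ends G e) ≡ y × proj₂ (ends G e) ≡ x)

-- cyclic successor in Fin (suc l)
next : ∀ {l} → Fin (suc l) → Fin (suc l)
next {zero} i = zero
next {suc l} zero = suc zero
next {suc l} (suc i) with next {l} i
... | zero = zero
... | suc j = suc (suc j)

record Circuit (G : Graph) : Set where
  field
    len : ℕ
    vs  : Fin (suc len) → V G
    es  : Fin (suc len) → E G
    vs-inj : Injective _≡_ _≡_ vs
    es-inj : Injective _≡_ _≡_ es
    es-in  : ∀ i → es i ∈ edges G
    joins  : ∀ i → Joins G (es i) (vs i) (vs (next i))
open Circuit public

countT : ∀ {n} → (Fin n → Bool) → ℕ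
countT {zero} f = 0
countT {suc n} f = (if f zero then 1 else 0) + countT (λ i → f (suc i))

Negative : (G : Graph) → EdgeSet G → Circuit G → Set
Negative G Σ' C = countT (λ i → Σ' (es C i)) % 2 ≡ 1

Balanced : (G : Graph) → EdgeSet G → Set
Balanced G Σ' = (C : Circuit G) → ¬ Negative G Σ' C

deleteEdges : (G : Graph) → EdgeSet G → Graph
deleteEdges G X = record G { edges = filter (λ e → Data.Bool.T? (not (X e))) (edges G) }
  where import Data.Bool

size : (G : Graph) → EdgeSet G → ℕ
size G X = length (filter (λ e → Data.Bool.T? (X e)) (edges G))
  where import Data.Bool

-- l(G,Σ) = t : some t-set of edges balances, and none smaller does
-- (Σ - X is represented by Σ itself, as only edges of G - X matter)
FrustrationIndex : (G : Graph) → EdgeSet G → ℕ → Set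
FrustrationIndex G Σ' t =
  (∃[ X ] (size G X ≡ t × Balanced (deleteEdges G X) Σ'))
  × (∀ X → Balanced (deleteEdges G X) Σ' → t ≤ size G X)

deleteEdge : (G : Graph) → DecidableEquality (E G) → E G → Graph
deleteEdge G _≟_ e = deleteEdges G (λ f → ⌊ f ≟ e ⌋)

Critical : (G : Graph) → DecidableEquality (E G) → EdgeSet G → ℕ → Set
Critical G _≟_ Σ' k =
  FrustrationIndex G Σ' k
  × (∀ e → e ∈ edges G → ∃[ t ] (t < k × FrustrationIndex (deleteEdge G _≟_ e) Σ' t))

cut : (G : Graph) → (V G → Bool) → EdgeSet G
cut G U e = U (proj₁ (ends G e)) xor U (proj₂ (ends G e))

signature : (G : Graph) → EdgeSet G → (V G → Bool) → EdgeSet G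
signature G Σ' U e = Σ' e xor cut G U e

DisjointE : (G : Graph) → EdgeSet G → EdgeSet G → Set
DisjointE G X Y = ∀ e → e ∈ edges G → X e ≡ true → Y e ≡ true → ⊥

-- Edges: (inj₁ i , w) is the Hamming-distance-1 edge
-- in coordinate i joining insertAt w i false and insertAt w i true;
-- (inj₂ tt , w) is the distance-k edge joining (false ∷ w) and
-- (true ∷ complement of w).  Each edge of H_k is listed exactly once.

HEdge : ℕ → Set
HEdge zero = ⊥
HEdge (suc k) = (Fin (suc k) ⊎ ⊤) × Vec Bool k

HEnds : (k : ℕ) → HEdge k → Vec Bool k × Vec Bool k
HEnds zero ()
HEnds (suc k) (inj₁ i , w) = insertAt w i false , insertAt w i true
HEnds (suc k) (inj₂ tt , w) = (false ∷ w) , (true ∷ map not w)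

allVecs : (n : ℕ) → List (Vec Bool n)
allVecs zero = [] ∷ []
allVecs (suc n) = L.map (false ∷_) (allVecs n) ++ L.map (true ∷_) (allVecs n)

HEdgeList : (k : ℕ) → List (HEdge k)
HEdgeList zero = []
HEdgeList (suc k) =
  cartesianProduct (L.map inj₁ (allFin (suc k)) ++ (inj₂ tt ∷ [])) (allVecs k)

H : ℕ → Graph
H k = record { V = Vec Bool k ; E = HEdge k ; ends = HEnds k ; edges = HEdgeList k }

-- negative edges: those joining strings at Hamming distance k
ΣH : (k : ℕ) → EdgeSet (H k)
ΣH zero ()
ΣH (suc k) (inj₁ _ , _) = false
ΣH (suc k) (inj₂ _ , _) = true

HEdge-≟ : (k : ℕ) → DecidableEquality (HEdge k)
HEdge-≟ zero ()
HEdge-≟ (suc k) = ×-≡-dec (⊎-≡-dec _≟F_ _≟U_) (≡-dec _≟B_)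

-- For every vertex x of H_k there is a circuit C_x of length
-- k + 1 with exactly one negative edge: jump from x to its antipode along the
-- distance-k edge, then restore the coordinates of x one at a time.  A set of
-- edges whose removal balances (H_k, Σ) meets every C_x, and an edge lies on
-- at most two of the 2^k circuits C_x, so it has at least 2^(k-1) edges.
--
-- The edges of H_k fall into k + 1 classes
-- of 2^(k-1) edges each: the distance-k edges, and for each coordinate i the
-- edges flipping coordinate i.  Each class is a signature (switching at
-- {x | x_i = true} trades Σ for the class of coordinate i), and deleting a
-- signature leaves a balanced graph.  Every edge lies in one of these
-- signatures, so deleting it lowers the frustration index.

module Submission where

open import Defs
open import Data.Nat using (ℕ; zero; suc; _≤_; _<_; _∸_; _^_; _+_; _*_; _%_; z≤n; s≤s)
open import Data.Nat.Properties
  using (0≢1+n; +-identityʳ; ≤-refl; m≤n⇒m≤1+n; 1+n≰n; ≤-reflexive; ≤-trans; ≤-pred; <-≤-trans; *-comm; *-identityˡ; *-cancelʳ-≤)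
open import Data.Nat.DivMod using (m*n%n≡0)
open import Data.Bool using (Bool; true; false; not; _xor_; if_then_else_; T)
open import Data.Bool.Properties
  using (T?; not-involutive; not-distribˡ-xor; xor-same; xor-comm; xor-identityʳ; xor-inverseʳ)
open import Data.Fin using (Fin; zero; suc; toℕ; splitAt; join; punchIn)
open import Data.Fin.Properties using (toℕ-injective; toℕ≤pred[n]; any?; join-splitAt)
  renaming (_≟_ to _≟F_)
open import Data.Vec using (Vec; []; _∷_; insertAt; lookup; head)
import Data.Vec as Vec
open import Data.Vec.Properties using (map-∘; map-cong; map-id; lookup-map)
open import Data.List using (List; []; _∷_; length; filter; _++_; cartesianProduct; allFin)
import Data.List as List
open import Data.List.Properties
  using (length-++; length-map; length-++-sucʳ; filter-++; filter-all; filter-none;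
         filter-notAll; filter-≐)
open import Data.List.Membership.Propositional using (_∈_)
import Data.List.Membership.DecPropositional as DecMembership
open import Data.List.Membership.Propositional.Properties
  using (∈-filter⁺; ∈-filter⁻; ∈-++⁺ˡ; ∈-++⁺ʳ; ∈-++⁻; ∈-∃++; ∈-map⁺; ∈-map⁻;
         ∈-allFin; ∈-cartesianProduct⁺)
open import Data.List.Relation.Unary.Any using (here; there)
import Data.List.Relation.Unary.Any as Any
open import Data.List.Relation.Unary.All using ([]; _∷_)
import Data.List.Relation.Unary.All as All
import Data.List.Relation.Unary.All.Properties as All
open import Data.List.Relation.Unary.AllPairs using ([]; _∷_)
open import Data.List.Relation.Unary.Unique.Propositional using (Unique)
import Data.List.Relation.Unary.Unique.Propositional.Properties as Unique
open import Data.Product using (_×_; _,_; proj₁; proj₂; ∃-syntax; Σ-syntax)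
open import Data.Sum using (_⊎_; inj₁; inj₂; map₂; [_,_]′)
open import Data.Sum.Properties using (inj₁-injective) renaming (≡-dec to ⊎-≡-dec)
open import Data.Unit using (⊤; tt)
open import Data.Unit.Properties using () renaming (_≟_ to _≟⊤_)
open import Data.Empty using (⊥; ⊥-elim)
open import Function using (_∘_; id)
open import Function.Definitions using (Injective)
open import Relation.Binary using (DecidableEquality)
open import Relation.Nullary using (¬_; Dec; yes; no; does)
open import Relation.Nullary.Decidable using (⌊_⌋; dec-true; dec-false; fromWitnessFalse; toWitnessFalse)
open import Level using (0ℓ)
open import Relation.Unary using (Pred; Decidable)
open import Relation.Binary.PropositionalEquality

length-≤-⊆-Unique : ∀ {A : Set} {xs ys : List A} →
  Unique xs → (∀ {x} → x ∈ xs → x ∈ ys) → length xs ≤ length ys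
length-≤-⊆-Unique {xs = []} _ _ = z≤n
length-≤-⊆-Unique {xs = x ∷ xs} (x∉xs ∷ unique) xs⊆ys with ∈-∃++ (xs⊆ys (here refl))
... | ys₁ , ys₂ , refl =
  ≤-trans (s≤s (length-≤-⊆-Unique unique xs⊆ys₁++ys₂)) (≤-reflexive (sym (length-++-sucʳ ys₁ x ys₂)))
  where
  xs⊆ys₁++ys₂ : ∀ {z} → z ∈ xs → z ∈ ys₁ ++ ys₂
  xs⊆ys₁++ys₂ z∈xs with ∈-++⁻ ys₁ (xs⊆ys (there z∈xs))
  ... | inj₁ z∈ys₁         = ∈-++⁺ˡ z∈ys₁
  ... | inj₂ (here refl)   = ⊥-elim (All.lookup x∉xs z∈xs refl)
  ... | inj₂ (there z∈ys₂) = ∈-++⁺ʳ ys₁ z∈ys₂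

∈-filter-not⊎∈-filter : ∀ {A : Set} (p : A → Bool) {x xs} → x ∈ xs →
  x ∈ filter (λ y → T? (not (p y))) xs ⊎ x ∈ filter (λ y → T? (p y)) xs
∈-filter-not⊎∈-filter p {x} x∈xs with p x in px
... | true  = inj₂ (∈-filter⁺ (λ y → T? (p y)) x∈xs (subst T (sym px) tt))
... | false = inj₁ (∈-filter⁺ (λ y → T? (not (p y))) x∈xs (subst (T ∘ not) (sym px) tt))

module _ {A : Set} {P Q : Pred A 0ℓ} (P? : Decidable P) (Q? : Decidable Q) where

  filter-comm : ∀ xs → filter P? (filter Q? xs) ≡ filter Q? (filter P? xs)
  filter-comm [] = refl
  filter-comm (x ∷ xs) with does (Q? x) in q | does (P? x) in p
  ... | true  | true  rewrite q | p = cong (x ∷_) (filter-comm xs)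
  ... | true  | false rewrite p = filter-comm xs
  ... | false | true  rewrite q = filter-comm xs
  ... | false | false = filter-comm xs

module _ {A B : Set} {P : Pred A 0ℓ} (P? : Decidable P) where
  open ≡-Reasoning

  filter-cartesianProduct : ∀ xs (ys : List B) →
    filter (P? ∘ proj₁) (cartesianProduct xs ys) ≡ cartesianProduct (filter P? xs) ys
  filter-cartesianProduct [] ys = refl
  filter-cartesianProduct (x ∷ xs) ys with P? x
  ... | yes px = begin
    filter (P? ∘ proj₁) (List.map (x ,_) ys ++ cartesianProduct xs ys)
      ≡⟨ filter-++ (P? ∘ proj₁) (List.map (x ,_) ys) _ ⟩
    filter (P? ∘ proj₁) (List.map (x ,_) ys) ++ filter (P? ∘ proj₁) (cartesianProduct xs ys)
      ≡⟨ cong₂ _++_ (filter-all (P? ∘ proj₁) (All.map⁺ (All.universal (λ _ → px) ys)))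
                    (filter-cartesianProduct xs ys) ⟩
    List.map (x ,_) ys ++ cartesianProduct (filter P? xs) ys ∎
  ... | no ¬px = begin
    filter (P? ∘ proj₁) (List.map (x ,_) ys ++ cartesianProduct xs ys)
      ≡⟨ filter-++ (P? ∘ proj₁) (List.map (x ,_) ys) _ ⟩
    filter (P? ∘ proj₁) (List.map (x ,_) ys) ++ filter (P? ∘ proj₁) (cartesianProduct xs ys)
      ≡⟨ cong₂ _++_ (filter-none (P? ∘ proj₁) (All.map⁺ (All.universal (λ _ → ¬px) ys)))
                    (filter-cartesianProduct xs ys) ⟩
    cartesianProduct (filter P? xs) ys ∎

length-cartesianProduct : ∀ {A B : Set} (xs : List A) (ys : List B) →
  length (cartesianProduct xs ys) ≡ length xs * length ys
length-cartesianProduct [] ys = refl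
length-cartesianProduct (x ∷ xs) ys = begin
  length (List.map (x ,_) ys ++ cartesianProduct xs ys)
    ≡⟨ length-++ (List.map (x ,_) ys) ⟩
  length (List.map (x ,_) ys) + length (cartesianProduct xs ys)
    ≡⟨ cong₂ _+_ (length-map (x ,_) ys) (length-cartesianProduct xs ys) ⟩
  length ys + length xs * length ys ∎
  where open ≡-Reasoning

module _ {A : Set} (_≟_ : DecidableEquality A) where

  length-filter-≡-Unique : ∀ {x xs} → Unique xs → x ∈ xs →
    length (filter (λ y → T? (does (y ≟ x))) xs) ≡ 1
  length-filter-≡-Unique {x} {y ∷ ys} (y∉ys ∷ unique) x∈y∷ys with y ≟ x
  ... | yes refl = cong (suc ∘ length)
    (filter-none (λ z → T? (does (z ≟ y))) (All.map (λ {z} y≢z → subst T (dec-false (z ≟ y) (y≢z ∘ sym))) y∉ys))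
  ... | no y≢x with x∈y∷ys
  ...   | here x≡y   = ⊥-elim (y≢x (sym x≡y))
  ...   | there x∈ys = length-filter-≡-Unique unique x∈ys

parity : ∀ {n} → (Fin n → Bool) → Bool
parity {zero}  f = false
parity {suc n} f = f zero xor parity (f ∘ suc)

parity-cong : ∀ {n} {f g : Fin n → Bool} → (∀ i → f i ≡ g i) → parity f ≡ parity g
parity-cong {zero}  f≗g = refl
parity-cong {suc n} f≗g = cong₂ _xor_ (f≗g zero) (parity-cong (f≗g ∘ suc))

countT-parity : ∀ {n} (f : Fin n → Bool) → ∃[ q ] countT f ≡ (if parity f then 1 else 0) + q * 2
countT-parity {zero} f = 0 , refl
countT-parity {suc n} f with f zero | parity (f ∘ suc) | countT-parity (f ∘ suc)
... | false | _     | q , eq = q , eq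
... | true  | false | q , eq = q , cong suc eq
... | true  | true  | q , eq = suc q , cong suc eq

countT-false : ∀ n → countT {n} (λ _ → false) ≡ 0
countT-false zero    = refl
countT-false (suc n) = countT-false n

parity-false⇒countT-even : ∀ {n} (f : Fin n → Bool) → parity f ≡ false → countT f % 2 ≡ 0
parity-false⇒countT-even f even with countT-parity f
... | q , eq rewrite even = trans (cong (_% 2) eq) (m*n%n≡0 q 2)

xor-telescope : ∀ x y z w → (x xor y) xor ((y xor z) xor w) ≡ (x xor z) xor w
xor-telescope false false z w = refl
xor-telescope false true  z w = trans (not-distribˡ-xor (not z) w) (cong (_xor w) (not-involutive z))
xor-telescope true  false z w = not-distribˡ-xor z w
xor-telescope true  true  z w = refl

next-suc : ∀ {l} (i : Fin (suc l)) → next {suc l} (suc i) ≡ punchIn (suc zero) (next i)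
next-suc {l} i with next {l} i
... | zero  = refl
... | suc j = refl

toℕ-next : ∀ {l} (i : Fin (suc l)) → (next i ≡ zero × toℕ i ≡ l) ⊎ toℕ (next i) ≡ suc (toℕ i)
toℕ-next {zero}  zero    = inj₁ (refl , refl)
toℕ-next {suc l} zero    = inj₂ refl
toℕ-next {suc l} (suc i) rewrite next-suc i with next i | toℕ-next i
... | zero  | inj₁ (_ , i≡l) = inj₁ (refl , cong suc i≡l)
... | suc j | inj₂ eq        = inj₂ (cong suc eq)

-- Dropping the second vertex merges a₀ ⊕ a₁ and a₁ ⊕ a₂ into a₀ ⊕ a₂.
parity-around-cycle : ∀ {l} (a : Fin (suc l) → Bool) → parity (λ i → a i xor a (next i)) ≡ false
parity-around-cycle {zero}  a = trans (xor-identityʳ _) (xor-same (a zero))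
parity-around-cycle {suc l} a = begin
  (a zero xor a (suc zero)) xor parity (λ i → a (suc i) xor a (next (suc i)))
    ≡⟨ cong ((a zero xor a (suc zero)) xor_) (parity-cong λ i → cong (λ j → a (suc i) xor a j) (next-suc i)) ⟩
  (a zero xor a (suc zero)) xor ((a (suc zero) xor b (next zero)) xor parity (λ i → b (suc i) xor b (next (suc i))))
    ≡⟨ xor-telescope (a zero) (a (suc zero)) (b (next zero)) _ ⟩
  parity (λ i → b i xor b (next i))
    ≡⟨ parity-around-cycle b ⟩
  false ∎
  where
  open ≡-Reasoning
  b : Fin (suc l) → Bool
  b = a ∘ punchIn (suc zero)

withEdges : (G : Graph) → List (E G) → Graph
withEdges G es = record G { edges = es }

xor≡false⇒≡ : ∀ {x y} → x xor y ≡ false → x ≡ y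
xor≡false⇒≡ {false} {false} _ = refl
xor≡false⇒≡ {true}  {true}  _ = refl

cut-Joins : (G : Graph) (U : V G → Bool) {e : E G} {x y : V G} →
  Joins G e x y → cut G U e ≡ U x xor U y
cut-Joins G U (inj₁ (refl , refl)) = refl
cut-Joins G U {e} (inj₂ (refl , refl)) = xor-comm (U (proj₁ (ends G e))) (U (proj₂ (ends G e)))

deleting-signature-balances : (G : Graph) (Σ' : EdgeSet G) (U : V G → Bool) →
  Balanced (deleteEdges G (signature G Σ' U)) Σ'
-- On the kept edges Σ' coincides with ∂(U), which a circuit crosses an even number of times.
deleting-signature-balances G Σ' U C negative = 0≢1+n (trans (sym even) negative)
  where
  S = signature G Σ' U
  sign≡cut : ∀ i → Σ' (es C i) ≡ U (vs C i) xor U (vs C (next i))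
  sign≡cut i = trans (xor≡false⇒≡ (not-true (proj₂ (∈-filter⁻ (λ e → T? (not (S e))) {xs = edges G} (es-in C i)))))
                     (cut-Joins G U (joins C i))
    where
    not-true : ∀ {b} → T (not b) → b ≡ false
    not-true {false} _ = refl
  even : countT (λ i → Σ' (es C i)) % 2 ≡ 0
  even = parity-false⇒countT-even (λ i → Σ' (es C i)) (trans (parity-cong sign≡cut) (parity-around-cycle (U ∘ vs C)))

size-cong : (G : Graph) {X Y : EdgeSet G} → (∀ e → X e ≡ Y e) → size G X ≡ size G Y
size-cong G X≗Y = cong length
  (filter-≐ (T? ∘ _) (T? ∘ _) ((λ {e} → subst T (X≗Y e)) , (λ {e} → subst T (sym (X≗Y e)))) (edges G))

size-deleteEdge-< : (G : Graph) (_≟_ : DecidableEquality (E G)) (X : EdgeSet G) {e : E G} →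
  e ∈ edges G → X e ≡ true → size (deleteEdge G _≟_ e) X < size G X
size-deleteEdge-< G _≟_ X {e} e∈G Xe =
  subst (_< size G X) (cong length (filter-comm (T? ∘ ≢e) (T? ∘ X) (edges G)))
    (filter-notAll (T? ∘ ≢e) _ (Any.map (λ { refl → e≢e }) e∈X))
  where
  ≢e : E G → Bool
  ≢e f = not ⌊ f ≟ e ⌋
  e≢e : ¬ T (≢e e)
  e≢e ≢e-holds = toWitnessFalse ≢e-holds refl
  e∈X : e ∈ filter (T? ∘ X) (edges G)
  e∈X = ∈-filter⁺ (T? ∘ X) e∈G (subst T (sym Xe) tt)

complement : ∀ {n} → Vec Bool n → Vec Bool n
complement = Vec.map not

complement-involutive : ∀ {n} (x : Vec Bool n) → complement (complement x) ≡ x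
complement-involutive x = begin
  Vec.map not (Vec.map not x) ≡⟨ map-∘ not not x ⟨
  Vec.map (not ∘ not) x       ≡⟨ map-cong not-involutive x ⟩
  Vec.map id x                ≡⟨ map-id x ⟩
  x                           ∎
  where open ≡-Reasoning

flipFirst : ∀ {n} → ℕ → Vec Bool n → Vec Bool n
flipFirst zero    v       = v
flipFirst (suc j) []      = []
flipFirst (suc j) (b ∷ v) = not b ∷ flipFirst j v

flipFirst-involutive : ∀ {n} j (v : Vec Bool n) → flipFirst j (flipFirst j v) ≡ v
flipFirst-involutive zero    v       = refl
flipFirst-involutive (suc j) []      = refl
flipFirst-involutive (suc j) (b ∷ v) = cong₂ _∷_ (not-involutive b) (flipFirst-involutive j v)

flipFirst-complement : ∀ {n} (x : Vec Bool n) → flipFirst n (complement x) ≡ x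
flipFirst-complement []      = refl
flipFirst-complement (b ∷ x) = cong₂ _∷_ (not-involutive b) (flipFirst-complement x)

hamming : ∀ {n} → Vec Bool n → Vec Bool n → ℕ
hamming []      []      = 0
hamming (a ∷ x) (b ∷ y) = (if a xor b then 1 else 0) + hamming x y

hamming-flipFirst : ∀ {n} j (v : Vec Bool n) → j ≤ n → hamming v (flipFirst j v) ≡ j
hamming-flipFirst zero    []          _         = refl
hamming-flipFirst zero    (false ∷ v) _         = hamming-flipFirst zero v z≤n
hamming-flipFirst zero    (true ∷ v)  _         = hamming-flipFirst zero v z≤n
hamming-flipFirst (suc j) (false ∷ v) (s≤s j≤n) = cong suc (hamming-flipFirst j v j≤n)
hamming-flipFirst (suc j) (true ∷ v)  (s≤s j≤n) = cong suc (hamming-flipFirst j v j≤n)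

hamming-complement : ∀ {n} (x : Vec Bool n) → hamming (complement x) x ≡ n
hamming-complement {n} x =
  trans (cong (hamming (complement x)) (sym (flipFirst-complement x)))
        (hamming-flipFirst n (complement x) ≤-refl)

allVecs-complete : ∀ {n} (v : Vec Bool n) → v ∈ allVecs n
allVecs-complete []          = here refl
allVecs-complete {suc n} (false ∷ v) = ∈-++⁺ˡ (∈-map⁺ (false ∷_) (allVecs-complete v))
allVecs-complete {suc n} (true ∷ v)  = ∈-++⁺ʳ (List.map (false ∷_) (allVecs n)) (∈-map⁺ (true ∷_) (allVecs-complete v))

allVecs-unique : ∀ n → Unique (allVecs n)
allVecs-unique zero    = [] ∷ []
allVecs-unique (suc n) =
  Unique.++⁺ (Unique.map⁺ ∷-injectiveʳ (allVecs-unique n)) (Unique.map⁺ ∷-injectiveʳ (allVecs-unique n)) heads-differ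
  where
  ∷-injectiveʳ : ∀ {b} {v w : Vec Bool n} → b ∷ v ≡ b ∷ w → v ≡ w
  ∷-injectiveʳ refl = refl
  heads-differ : ∀ {v} → v ∈ List.map (false ∷_) (allVecs n) × v ∈ List.map (true ∷_) (allVecs n) → ⊥
  heads-differ (v∈false∷ , v∈true∷) with ∈-map⁻ (false ∷_) v∈false∷ | ∈-map⁻ (true ∷_) v∈true∷
  ... | _ , _ , refl | _ , _ , ()

length-allVecs : ∀ n → length (allVecs n) ≡ 2 ^ n
length-allVecs zero    = refl
length-allVecs (suc n) = begin
  length (List.map (false ∷_) (allVecs n) ++ List.map (true ∷_) (allVecs n))
    ≡⟨ length-++ (List.map (false ∷_) (allVecs n)) ⟩
  length (List.map (false ∷_) (allVecs n)) + length (List.map (true ∷_) (allVecs n))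
    ≡⟨ cong₂ _+_ (length-map (false ∷_) (allVecs n)) (length-map (true ∷_) (allVecs n)) ⟩
  length (allVecs n) + length (allVecs n)
    ≡⟨ cong₂ _+_ (length-allVecs n) (trans (length-allVecs n) (sym (+-identityʳ (2 ^ n)))) ⟩
  2 ^ suc n ∎
  where open ≡-Reasoning

-- The negative circuits C_x

antipodalLabel : ∀ {m} → Vec Bool (suc m) → Vec Bool m
antipodalLabel (false ∷ w) = w
antipodalLabel (true ∷ w)  = complement w

stepLabel : ∀ {n} → Fin (suc n) → Vec Bool (suc n) → Vec Bool n
stepLabel zero          (b ∷ v) = v
stepLabel {suc n} (suc i) (b ∷ v) = not b ∷ stepLabel i v

insertAt-stepLabel : ∀ {n} (i : Fin (suc n)) (v : Vec Bool (suc n)) →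
  insertAt (stepLabel i v) i (lookup v i) ≡ flipFirst (toℕ i) v
insertAt-stepLabel zero          (b ∷ v) = refl
insertAt-stepLabel {suc n} (suc i) (b ∷ v) = cong (not b ∷_) (insertAt-stepLabel i v)

insertAt-stepLabel-not : ∀ {n} (i : Fin (suc n)) (v : Vec Bool (suc n)) →
  insertAt (stepLabel i v) i (not (lookup v i)) ≡ flipFirst (suc (toℕ i)) v
insertAt-stepLabel-not zero          (b ∷ v) = refl
insertAt-stepLabel-not {suc n} (suc i) (b ∷ v) = cong (not b ∷_) (insertAt-stepLabel-not i v)

circuitVertex : ∀ {m} → Vec Bool (suc m) → ℕ → Vec Bool (suc m)
circuitVertex x zero    = x
circuitVertex x (suc j) = flipFirst j (complement x)

circuitEdge : ∀ {m} → Vec Bool (suc m) → Fin (suc (suc m)) → HEdge (suc m)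
circuitEdge x zero    = inj₂ tt , antipodalLabel x
circuitEdge x (suc i) = inj₁ i , stepLabel i (complement x)

circuitVertex-injective : ∀ {m} (x : Vec Bool (suc m)) →
  Injective _≡_ _≡_ (λ (j : Fin (suc (suc m))) → circuitVertex x (toℕ j))
-- The vertices of C_x are told apart by their Hamming distance from the antipode of x.
circuitVertex-injective {m} x {j} {j′} eq =
  position-injective (trans (sym (distance j)) (trans (cong (hamming (complement x)) eq) (distance j′)))
  where
  position : Fin (suc (suc m)) → ℕ
  position zero    = suc m
  position (suc i) = toℕ i
  distance : ∀ j → hamming (complement x) (circuitVertex x (toℕ j)) ≡ position j
  distance zero    = hamming-complement x
  distance (suc i) = hamming-flipFirst (toℕ i) (complement x) (m≤n⇒m≤1+n (toℕ≤pred[n] i))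
  position-injective : ∀ {j j′} → position j ≡ position j′ → j ≡ j′
  position-injective {zero}  {zero}   _  = refl
  position-injective {zero}  {suc i}  eq = ⊥-elim (1+n≰n (subst (_≤ m) (sym eq) (toℕ≤pred[n] i)))
  position-injective {suc i} {zero}   eq = ⊥-elim (1+n≰n (subst (_≤ m) eq (toℕ≤pred[n] i)))
  position-injective {suc i} {suc i′} eq = cong suc (toℕ-injective eq)

circuitVertex-next : ∀ {m} (x : Vec Bool (suc m)) (i : Fin (suc m)) →
  circuitVertex x (toℕ (next (suc i))) ≡ flipFirst (suc (toℕ i)) (complement x)
circuitVertex-next x i with toℕ-next (suc i)
... | inj₁ (next≡zero , i≡m) rewrite next≡zero =
  sym (trans (cong (λ j → flipFirst j (complement x)) i≡m) (flipFirst-complement x))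
... | inj₂ eq = cong (circuitVertex x) eq

circuitEdge-joins : ∀ {m} (x : Vec Bool (suc m)) (j : Fin (suc (suc m))) →
  Joins (H (suc m)) (circuitEdge x j) (circuitVertex x (toℕ j)) (circuitVertex x (toℕ (next j)))
circuitEdge-joins (false ∷ w) zero = inj₁ (refl , refl)
circuitEdge-joins (true ∷ w)  zero = inj₂ (refl , cong (true ∷_) (complement-involutive w))
circuitEdge-joins x (suc i)
  with lookup (complement x) i | insertAt-stepLabel i (complement x) | insertAt-stepLabel-not i (complement x)
... | false | start | end = inj₁ (start , trans end (sym (circuitVertex-next x i)))
... | true  | start | end = inj₂ (trans end (sym (circuitVertex-next x i)) , start)

circuitEdge-injective : ∀ {m} (x : Vec Bool (suc m)) → Injective _≡_ _≡_ (circuitEdge x)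
circuitEdge-injective x {zero}  {zero}   _  = refl
circuitEdge-injective x {suc i} {suc i′} eq = cong suc (inj₁-injective (cong proj₁ eq))

circuit : ∀ {m} (es : List (HEdge (suc m))) (x : Vec Bool (suc m)) →
  (∀ j → circuitEdge x j ∈ es) → Circuit (withEdges (H (suc m)) es)
circuit {m} es x kept = record
  { len    = suc m
  ; vs     = circuitVertex x ∘ toℕ
  ; es     = circuitEdge x
  ; vs-inj = circuitVertex-injective x
  ; es-inj = circuitEdge-injective x
  ; es-in  = kept
  ; joins  = circuitEdge-joins x
  }

circuit-negative : ∀ {m} (es : List (HEdge (suc m))) (x : Vec Bool (suc m)) (kept : ∀ j → circuitEdge x j ∈ es) →
  Negative (withEdges (H (suc m)) es) (ΣH (suc m)) (circuit es x kept)
circuit-negative {m} _ _ _ = cong (λ n → suc n % 2) (countT-false (suc m))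

circuitBit : ∀ {m} → Vec Bool (suc m) → Fin (suc (suc m)) → Bool
circuitBit x zero    = head x
circuitBit x (suc i) = lookup (complement x) i

-- An edge lies on at most two of the circuits C_x: together with one bit it determines x.
circuitStart : ∀ {m} → HEdge (suc m) × Bool → Vec Bool (suc m)
circuitStart ((inj₂ tt , w) , false) = false ∷ w
circuitStart ((inj₂ tt , w) , true)  = true ∷ complement w
circuitStart ((inj₁ i , w) , b)      = complement (flipFirst (toℕ i) (insertAt w i b))

circuitStart-circuitEdge : ∀ {m} (x : Vec Bool (suc m)) j → circuitStart (circuitEdge x j , circuitBit x j) ≡ x
circuitStart-circuitEdge (false ∷ w) zero = refl
circuitStart-circuitEdge (true ∷ w)  zero = cong (true ∷_) (complement-involutive w)
circuitStart-circuitEdge x (suc i) = begin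
  complement (flipFirst (toℕ i) (insertAt (stepLabel i (complement x)) i (lookup (complement x) i)))
    ≡⟨ cong (complement ∘ flipFirst (toℕ i)) (insertAt-stepLabel i (complement x)) ⟩
  complement (flipFirst (toℕ i) (flipFirst (toℕ i) (complement x)))
    ≡⟨ cong complement (flipFirst-involutive (toℕ i) (complement x)) ⟩
  complement (complement x)
    ≡⟨ complement-involutive x ⟩
  x ∎
  where open ≡-Reasoning

circuit-hitting-set-size : ∀ {m} (M : List (HEdge (suc m))) →
  (∀ x → ∃[ j ] circuitEdge x j ∈ M) → 2 ^ m ≤ length M
circuit-hitting-set-size {m} M hits = *-cancelʳ-≤ (2 ^ m) (length M) 2 (begin
  2 ^ m * 2                                  ≡⟨ *-comm (2 ^ m) 2 ⟩
  2 ^ suc m                                  ≡⟨ length-allVecs (suc m) ⟨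
  length (allVecs (suc m))                   ≡⟨ length-map code (allVecs (suc m)) ⟨
  length (List.map code (allVecs (suc m)))   ≤⟨ length-≤-⊆-Unique (Unique.map⁺ code-injective (allVecs-unique (suc m))) code∈ ⟩
  length (cartesianProduct M bits)           ≡⟨ length-cartesianProduct M bits ⟩
  length M * 2                               ∎)
  where
  open Data.Nat.Properties.≤-Reasoning
  bits : List Bool
  bits = false ∷ true ∷ []
  bits-complete : ∀ b → b ∈ bits
  bits-complete false = here refl
  bits-complete true  = there (here refl)
  code : Vec Bool (suc m) → HEdge (suc m) × Bool
  code x = circuitEdge x (proj₁ (hits x)) , circuitBit x (proj₁ (hits x))
  code-injective : Injective _≡_ _≡_ code
  code-injective {x} {y} eq =
    trans (sym (circuitStart-circuitEdge x (proj₁ (hits x))))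
          (trans (cong circuitStart eq) (circuitStart-circuitEdge y (proj₁ (hits y))))
  code∈ : ∀ {c} → c ∈ List.map code (allVecs (suc m)) → c ∈ cartesianProduct M bits
  code∈ c∈ with ∈-map⁻ code c∈
  ... | x , _ , refl = ∈-cartesianProduct⁺ (proj₂ (hits x)) (bits-complete _)

balanced⇒circuits-hit : ∀ {m} (es M : List (HEdge (suc m))) → (∀ e → e ∈ es ⊎ e ∈ M) →
  Balanced (withEdges (H (suc m)) es) (ΣH (suc m)) → ∀ x → ∃[ j ] circuitEdge x j ∈ M
balanced⇒circuits-hit {m} es M cover balanced x with any? (λ j → DecMembership._∈?_ (HEdge-≟ (suc m)) (circuitEdge x j) M)
... | yes hit  = hit
... | no ¬hit = ⊥-elim (balanced (circuit es x kept) (circuit-negative es x kept))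
  where
  kept : ∀ j → circuitEdge x j ∈ es
  kept j = [ id , (λ e∈M → ⊥-elim (¬hit (j , e∈M))) ]′ (cover (circuitEdge x j))

balancing-set-size : ∀ {m} (es M : List (HEdge (suc m))) → (∀ e → e ∈ es ⊎ e ∈ M) →
  Balanced (withEdges (H (suc m)) es) (ΣH (suc m)) → 2 ^ m ≤ length M
balancing-set-size es M cover balanced = circuit-hitting-set-size M (balanced⇒circuits-hit es M cover balanced)

-- Edge classes and their signatures

EdgeClass : ℕ → Set
EdgeClass k = Fin k ⊎ ⊤

_≟ᶜ_ : ∀ {k} → DecidableEquality (EdgeClass k)
_≟ᶜ_ = ⊎-≡-dec _≟F_ _≟⊤_

edgeClasses : (k : ℕ) → List (EdgeClass k)
edgeClasses k = List.map inj₁ (allFin k) ++ inj₂ tt ∷ []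

edgeClasses-complete : ∀ {k} (c : EdgeClass k) → c ∈ edgeClasses k
edgeClasses-complete {k} (inj₁ i)  = ∈-++⁺ˡ (∈-map⁺ inj₁ (∈-allFin i))
edgeClasses-complete {k} (inj₂ tt) = ∈-++⁺ʳ (List.map inj₁ (allFin k)) (here refl)

edgeClasses-unique : ∀ k → Unique (edgeClasses k)
edgeClasses-unique k =
  Unique.++⁺ (Unique.map⁺ inj₁-injective (Unique.allFin⁺ k)) ([] ∷ []) inj₁≢inj₂
  where
  inj₁≢inj₂ : ∀ {c} → c ∈ List.map inj₁ (allFin k) × c ∈ inj₂ tt ∷ [] → ⊥
  inj₁≢inj₂ (c∈inj₁ , here refl) with ∈-map⁻ inj₁ c∈inj₁
  ... | _ , _ , ()

HEdgeList-complete : ∀ {m} (e : HEdge (suc m)) → e ∈ HEdgeList (suc m)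
HEdgeList-complete (c , w) = ∈-cartesianProduct⁺ (edgeClasses-complete c) (allVecs-complete w)

cutOf : ∀ {k} → EdgeClass k → Vec Bool k → Bool
cutOf (inj₁ i)  v = lookup v i
cutOf (inj₂ tt) v = false

lookup-insertAt-xor : ∀ {n} (w : Vec Bool n) (j i : Fin (suc n)) →
  lookup (insertAt w j false) i xor lookup (insertAt w j true) i ≡ does (j ≟F i)
lookup-insertAt-xor w       zero    zero    = refl
lookup-insertAt-xor w       zero    (suc i) = xor-same (lookup w i)
lookup-insertAt-xor (a ∷ w) (suc j) zero    = xor-same a
lookup-insertAt-xor (a ∷ w) (suc j) (suc i) = lookup-insertAt-xor w j i

lookup-antipodes-xor : ∀ {n} (w : Vec Bool n) (i : Fin (suc n)) →
  lookup (false ∷ w) i xor lookup (true ∷ complement w) i ≡ true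
lookup-antipodes-xor w zero    = refl
lookup-antipodes-xor w (suc i) = trans (cong (lookup w i xor_) (lookup-map i not w)) (xor-inverseʳ (lookup w i))

signature-cutOf : ∀ {m} (c : EdgeClass (suc m)) (e : HEdge (suc m)) →
  signature (H (suc m)) (ΣH (suc m)) (cutOf c) e ≡ does (proj₁ e ≟ᶜ c)
signature-cutOf (inj₁ i)  (inj₁ j , w)  = lookup-insertAt-xor w j i
signature-cutOf (inj₂ tt) (inj₁ j , w)  = refl
signature-cutOf (inj₁ i)  (inj₂ tt , w) = cong not (lookup-antipodes-xor w i)
signature-cutOf (inj₂ tt) (inj₂ tt , w) = refl

size-signature-cutOf : ∀ {m} (c : EdgeClass (suc m)) →
  size (H (suc m)) (signature (H (suc m)) (ΣH (suc m)) (cutOf c)) ≡ 2 ^ m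
size-signature-cutOf {m} c = begin
  size (H (suc m)) (signature (H (suc m)) (ΣH (suc m)) (cutOf c))
    ≡⟨ size-cong (H (suc m)) (signature-cutOf c) ⟩
  length (filter (isC? ∘ proj₁) (cartesianProduct (edgeClasses (suc m)) (allVecs m)))
    ≡⟨ cong length (filter-cartesianProduct isC? (edgeClasses (suc m)) (allVecs m)) ⟩
  length (cartesianProduct (filter isC? (edgeClasses (suc m))) (allVecs m))
    ≡⟨ length-cartesianProduct (filter isC? (edgeClasses (suc m))) (allVecs m) ⟩
  length (filter isC? (edgeClasses (suc m))) * length (allVecs m)
    ≡⟨ cong₂ _*_ (length-filter-≡-Unique _≟ᶜ_ (edgeClasses-unique (suc m)) (edgeClasses-complete c))
                 (length-allVecs m) ⟩
  1 * 2 ^ m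
    ≡⟨ *-identityˡ (2 ^ m) ⟩
  2 ^ m ∎
  where
  open ≡-Reasoning
  isC? : (c′ : EdgeClass (suc m)) → Dec (T (does (c′ ≟ᶜ c)))
  isC? c′ = T? (does (c′ ≟ᶜ c))

signature-cutOf-own : ∀ {m} (e : HEdge (suc m)) → signature (H (suc m)) (ΣH (suc m)) (cutOf (proj₁ e)) e ≡ true
signature-cutOf-own e = trans (signature-cutOf (proj₁ e) e) (dec-true (proj₁ e ≟ᶜ proj₁ e) refl)

signature-cutOf-true : ∀ {m} (c : EdgeClass (suc m)) (e : HEdge (suc m)) →
  signature (H (suc m)) (ΣH (suc m)) (cutOf c) e ≡ true → proj₁ e ≡ c
signature-cutOf-true c e Se with proj₁ e ≟ᶜ c | signature-cutOf c e
... | yes e∈c | _       = e∈c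
... | no _    | Se≡false with trans (sym Se) Se≡false
...   | ()

signature-cutOf-disjoint : ∀ {m} {c c′ : EdgeClass (suc m)} → c ≢ c′ →
  DisjointE (H (suc m)) (signature (H (suc m)) (ΣH (suc m)) (cutOf c)) (signature (H (suc m)) (ΣH (suc m)) (cutOf c′))
signature-cutOf-disjoint {c = c} {c′} c≢c′ e _ Se Se′ =
  c≢c′ (trans (sym (signature-cutOf-true c e Se)) (signature-cutOf-true c′ e Se′))

classOf : ∀ {k} → Fin (k + 1) → EdgeClass k
classOf {k} u = map₂ (λ _ → tt) (splitAt k u)

classOf-injective : ∀ {k} → Injective _≡_ _≡_ (classOf {k})
classOf-injective {k} {u} {u′} eq = begin
  u                        ≡⟨ join-splitAt k 1 u ⟨
  join k 1 (splitAt k u)   ≡⟨ cong (join k 1) (forget-injective (splitAt k u) (splitAt k u′) eq) ⟩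
  join k 1 (splitAt k u′)  ≡⟨ join-splitAt k 1 u′ ⟩
  u′                       ∎
  where
  open ≡-Reasoning
  forget-injective : ∀ (s t : Fin k ⊎ Fin 1) → map₂ (λ _ → tt) s ≡ map₂ (λ _ → tt) t → s ≡ t
  forget-injective (inj₁ a)    (inj₁ .a)   refl = refl
  forget-injective (inj₂ zero) (inj₂ zero) _    = refl

H-frustrationIndex : ∀ m → FrustrationIndex (H (suc m)) (ΣH (suc m)) (2 ^ m)
H-frustrationIndex m =
  ( signature (H (suc m)) (ΣH (suc m)) (cutOf (inj₂ tt))
  , size-signature-cutOf {m} (inj₂ tt)
  , deleting-signature-balances (H (suc m)) (ΣH (suc m)) (cutOf (inj₂ tt)) )
  , λ X balanced → balancing-set-size _ _ (λ e → ∈-filter-not⊎∈-filter X (HEdgeList-complete e)) balanced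

H-deleteEdge-frustrationIndex : ∀ m (e : HEdge (suc m)) →
  ∃[ t ] (t < 2 ^ m × FrustrationIndex (deleteEdge (H (suc m)) (HEdge-≟ (suc m)) e) (ΣH (suc m)) t)
H-deleteEdge-frustrationIndex m e =
  size G S , t<2^m
  , (S , refl , deleting-signature-balances G (ΣH (suc m)) (cutOf (proj₁ e)))
  , λ X balanced → ≤-pred (<-≤-trans t<2^m (balancing-set-size _ (e ∷ _) (cover X) balanced))
  where
  G = deleteEdge (H (suc m)) (HEdge-≟ (suc m)) e
  S = signature (H (suc m)) (ΣH (suc m)) (cutOf (proj₁ e))
  t<2^m : size G S < 2 ^ m
  t<2^m = subst (size G S <_) (size-signature-cutOf (proj₁ e))
    (size-deleteEdge-< (H (suc m)) (HEdge-≟ (suc m)) S (HEdgeList-complete e) (signature-cutOf-own e))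
  cover : ∀ X f → f ∈ edges (deleteEdges G X) ⊎ f ∈ e ∷ filter (T? ∘ X) (edges G)
  cover X f with HEdge-≟ (suc m) f e
  ... | yes refl = inj₂ (here refl)
  ... | no f≢e   = map₂ there (∈-filter-not⊎∈-filter X (∈-filter⁺ _ (HEdgeList-complete f) (fromWitnessFalse f≢e)))

proposition2p6 : (k : ℕ) → 1 ≤ k →
    Critical (H k) (HEdge-≟ k) (ΣH k) (2 ^ (k ∸ 1))
    × (Σ[ U ∈ (Fin (k + 1) → Vec Bool k → Bool) ] ((∀ (i : Fin (k + 1)) → size (H k) (signature (H k) (ΣH k) (U i)) ≡ 2 ^ (k ∸ 1))
    × (∀ (i j : Fin (k + 1)) → i ≢ j →
    DisjointE (H k) (signature (H k) (ΣH k) (U i)) (signature (H k) (ΣH k) (U j)))))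
proposition2p6 (suc m) _ =
  (H-frustrationIndex m , λ e _ → H-deleteEdge-frustrationIndex m e)
  , cutOf ∘ classOf
  , (λ u → size-signature-cutOf (classOf u))
  , λ u u′ u≢u′ → signature-cutOf-disjoint (u≢u′ ∘ classOf-injective)
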